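{- Let $T$ be an ordinary tree on $n$ vertices and $r\ge3$ an integer. Then $$\varphi(T^r,x)=x^{\frac{(n-2)(r-2)}{2}}\,\varphi(T,x^{r/2}).$$
   Context: For an $r$-uniform hypergraph $\mathcal{H}$ on $N$ vertices (including ordinary graphs, $r=2$), $m(\mathcal{H},k)$ is the number of sets of $k$ pairwise disjoint edges ($m(\mathcal{H},0)=1$) and $\varphi(\mathcal{H},x)=\sum_{k\ge0}(-1)^k m(\mathcal{H},k)x^{N-kr}$; for the tree $T$ this is $\sum_k(-1)^k m(T,k)x^{n-2k}$. The $r$-th power $T^r$ of an ordinary graph $T$ is the $r$-uniform hypergraph obtained by adding to each edge of $T$ $r-2$ new vertices (distinct for distinct edges). -}

module Defs where

open import Data.Nat as ℕ using (ℕ; zero; suc; _∸_)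
open import Data.Integer as ℤ using (ℤ; +_; -_)
open import Data.Fin as Fin using (Fin; splitAt; remQuot)
open import Data.Fin.Properties using () renaming (_≟_ to _≟ᶠ_)
open import Data.Bool using (Bool; true; false; _∧_; _∨_; not)
open import Data.List as List using (List; []; _∷_; length; filterᵇ; allFin; map; lookup)
open import Data.Product using (_×_; _,_; proj₁; proj₂)
open import Data.Sum using (inj₁; inj₂)
open import Relation.Nullary.Decidable using (⌊_⌋)
open import Relation.Binary.PropositionalEquality using (_≡_; _≢_)
open import Relation.Nullary using (¬_)
open import Data.Unit using (⊤)
open import Data.List.Membership.Propositional using (_∈_)

record Hypergraph : Set where
  field
    N     : ℕ
    edges : List (Fin N → Bool)
open Hypergraph public

allᵇ : ∀ {A : Set} → (A → Bool) → List A → Bool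
allᵇ p []       = true
allᵇ p (x ∷ xs) = p x ∧ allᵇ p xs

disjointᵇ : ∀ {N} → (Fin N → Bool) → (Fin N → Bool) → Bool
disjointᵇ {N} e f = allᵇ (λ v → not (e v ∧ f v)) (allFin N)

sublists : ∀ {A : Set} → List A → List (List A)
sublists []       = [] ∷ []
sublists (x ∷ xs) = map (x ∷_) (sublists xs) List.++ sublists xs

pairwiseDisjointᵇ : ∀ {N} → List (Fin N → Bool) → Bool
pairwiseDisjointᵇ []       = true
pairwiseDisjointᵇ (e ∷ es) = allᵇ (disjointᵇ e) es ∧ pairwiseDisjointᵇ es

m : Hypergraph → ℕ → ℕ
m H k = length (filterᵇ (λ s → ⌊ length s ℕ.≟ k ⌋ ∧ pairwiseDisjointᵇ s)
                        (sublists (edges H)))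

sumTo : ℕ → (ℕ → ℤ) → ℤ
sumTo zero    f = f 0
sumTo (suc K) f = sumTo K f ℤ.+ f (suc K)

-- value at x of φ(H,x) = Σ_k (-1)^k m(H,k) x^(N - k r)
-- (terms with k > number of edges vanish, since then m(H,k) = 0; also
--  m(H,k) = 0 whenever k r > N for r-uniform H, so ∸ is harmless)
φ : ℕ → Hypergraph → ℤ → ℤ
φ r H x = sumTo (length (edges H))
  (λ k → ((- (+ 1)) ℤ.^ k) ℤ.* (+ m H k) ℤ.* (x ℤ.^ (N H ∸ k ℕ.* r)))

record Graph (n : ℕ) : Set where
  field
    E : List (Fin n × Fin n)
open Graph public

NoRepeat : ∀ {n} → List (Fin n × Fin n) → Set
NoRepeat []             = ⊤
NoRepeat ((u , v) ∷ es) = ¬ ((u , v) ∈ es) × ¬ ((v , u) ∈ es) × NoRepeat es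

IsSimple : ∀ {n} → Graph n → Set
IsSimple G = (∀ {u v} → (u , v) ∈ E G → u ≢ v) × NoRepeat (E G)

data Reachable {n} (G : Graph n) : Fin n → Fin n → Set where
  here  : ∀ {u} → Reachable G u u
  fwd   : ∀ {u v w} → (u , v) ∈ E G → Reachable G v w → Reachable G u w
  bwd   : ∀ {u v w} → (v , u) ∈ E G → Reachable G v w → Reachable G u w

Connected : ∀ {n} → Graph n → Set
Connected G = ∀ u v → Reachable G u v

IsTree : ∀ {n} → Graph n → Set
IsTree {n} G = IsSimple G × Connected G × (1 ℕ.≤ n) × (length (E G) ≡ n ∸ 1)

eqᵇ : ∀ {n} → Fin n → Fin n → Bool
eqᵇ a b = ⌊ a ≟ᶠ b ⌋

graphHyper : ∀ {n} → Graph n → Hypergraph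
graphHyper {n} G = record
  { N = n
  ; edges = map (λ { (a , b) v → eqᵇ v a ∨ eqᵇ v b }) (E G) }

-- T^r: add r-2 new vertices to every edge (distinct for distinct edges).
-- Vertices: Fin (n + |E| * (r-2)); the first n are the old ones, vertex
-- n + (i*(r-2) + j) is the j-th new vertex on edge number i.
power : ∀ {n} → Graph n → ℕ → Hypergraph
power {n} G r = record
  { N = n ℕ.+ length (E G) ℕ.* (r ∸ 2)
  ; edges = List.tabulate edge }
  where
  e = length (E G)
  edge : Fin e → Fin (n ℕ.+ e ℕ.* (r ∸ 2)) → Bool
  edge i v with splitAt n v
  ... | inj₁ u = eqᵇ u (proj₁ (lookup (E G) i)) ∨ eqᵇ u (proj₂ (lookup (E G) i))
  ... | inj₂ w = eqᵇ (proj₁ (remQuot (r ∸ 2) w)) i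

module Submission where

open import Defs
open import Data.Nat using (ℕ; _≤_; _∸_; _*_)
open import Data.Integer using (ℤ; +_) renaming (_*_ to _*ℤ_; _^_ to _^ℤ_)
open import Relation.Binary.PropositionalEquality using (_≡_)

open import Data.Nat using (zero; suc; _+_; z≤n; s≤s)
import Data.Nat.Properties as ℕP
open import Data.Nat.Tactic.RingSolver using (solve-∀)
import Data.Integer as ℤ
import Data.Integer.Properties as ℤP
open import Data.Fin as Fin using (Fin; splitAt; remQuot; _↑ˡ_)
import Data.Fin.Properties as FinP
open import Data.Bool using (Bool; true; false; _∧_; _∨_; not)
open import Data.Bool.Properties using (∧-zeroʳ; ∧-distribˡ-∨)
open import Data.List using (List; []; _∷_; length; filterᵇ; allFin; map; lookup; tabulate; _++_)
import Data.List.Properties as ListP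
open import Data.List.Relation.Unary.All as All using (All; []; _∷_)
import Data.List.Relation.Unary.All.Properties as AllP
open import Data.List.Relation.Unary.AllPairs using (AllPairs; []; _∷_)
import Data.List.Relation.Unary.AllPairs.Properties as AllPairsP
open import Data.List.Relation.Unary.Any using (here; there)
open import Data.List.Membership.Propositional using (_∈_)
import Data.List.Membership.Propositional.Properties as ∈P
open import Data.List.Relation.Binary.Sublist.Propositional using (_⊆_; []; _∷_; _∷ʳ_)
open import Data.List.Relation.Binary.Sublist.Propositional.Properties using (All-resp-⊆)
open import Data.Product using (Σ; _×_; _,_; proj₁; proj₂)
open import Data.Sum using (inj₁; inj₂)
open import Data.Empty using (⊥-elim)
open import Relation.Binary.PropositionalEquality
  using (refl; sym; trans; cong; cong₂; _≢_; module ≡-Reasoning)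
open import Relation.Nullary using (Dec; yes; no)
open import Relation.Nullary.Decidable using (⌊_⌋)
open import Function using (_∘_)

-- Write r = s + 2 and e = n - 1 for the number of edges of T.
--  (1) Matching counts agree: m(Tʳ, k) = m(T, k). The count m only depends
--      on which pairs of edges are disjoint (matchings-transfer), and two
--      distinct edges of Tʳ are disjoint iff the corresponding edges of T are,
--      since the added vertices are private to their edge (m-power).
--  (2) If m(T, k) ≠ 0 then 2k ≤ n: k disjoint edges with 2 vertices each
--      cover 2k vertices (matching-bound, for any uniform hypergraph).
--  (3) For such k the exponents of y in the k-th terms of both sides agree:
--      s + 2(n + es - kr) = es + r(n - 2k) (exponents-agree).
-- The theorem is then a termwise comparison of the two sums; terms with
-- m(T, k) = 0 vanish on both sides.

∧-true : ∀ {a b} → a ∧ b ≡ true → a ≡ true × b ≡ true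
∧-true {true} {true} _ = refl , refl

bool-ext : ∀ {a b : Bool} → (a ≡ true → b ≡ true) → (b ≡ true → a ≡ true) → a ≡ b
bool-ext {false} {false} _ _ = refl
bool-ext {false} {true}  _ g = g refl
bool-ext {true}  {false} f _ = sym (f refl)
bool-ext {true}  {true}  _ _ = refl

not-true : ∀ {b} → not b ≡ true → b ≡ false
not-true {false} _ = refl

isYes-sound : ∀ {A : Set} (d : Dec A) → ⌊ d ⌋ ≡ true → A
isYes-sound (yes a) _ = a

eqᵇ-refl : ∀ {n} (a : Fin n) → eqᵇ a a ≡ true
eqᵇ-refl a with a FinP.≟ a
... | yes _ = refl
... | no a≢a = ⊥-elim (a≢a refl)

eqᵇ-≢ : ∀ {n} {a b : Fin n} → a ≢ b → eqᵇ a b ≡ false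
eqᵇ-≢ {a = a} {b} a≢b with a FinP.≟ b
... | yes a≡b = ⊥-elim (a≢b a≡b)
... | no _ = refl

eqᵇ-suc : ∀ {n} (v a : Fin n) → eqᵇ (Fin.suc v) (Fin.suc a) ≡ eqᵇ v a
eqᵇ-suc v a with v FinP.≟ a
... | yes _ = refl
... | no _ = refl

allᵇ-sound : ∀ {A : Set} (p : A → Bool) xs → allᵇ p xs ≡ true → ∀ {x} → x ∈ xs → p x ≡ true
allᵇ-sound p (y ∷ ys) h (here refl) = proj₁ (∧-true h)
allᵇ-sound p (y ∷ ys) h (there x∈ys) = allᵇ-sound p ys (proj₂ (∧-true h)) x∈ys

allᵇ-complete : ∀ {A : Set} (p : A → Bool) xs → (∀ {x} → x ∈ xs → p x ≡ true) → allᵇ p xs ≡ true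
allᵇ-complete p [] h = refl
allᵇ-complete p (y ∷ ys) h = cong₂ _∧_ (h (here refl)) (allᵇ-complete p ys (h ∘ there))

Disjoint : ∀ {N} → (Fin N → Bool) → (Fin N → Bool) → Set
Disjoint e f = ∀ v → e v ∧ f v ≡ false

disjointᵇ-sound : ∀ {N} (e f : Fin N → Bool) → disjointᵇ e f ≡ true → Disjoint e f
disjointᵇ-sound {N} e f h v = not-true (allᵇ-sound _ (allFin N) h (∈P.∈-allFin v))

disjointᵇ-complete : ∀ {N} (e f : Fin N → Bool) → Disjoint e f → disjointᵇ e f ≡ true
disjointᵇ-complete {N} e f h = allᵇ-complete _ (allFin N) (λ {v} _ → cong not (h v))

disjointᵇ-≡ : ∀ {N₁ N₂} (e f : Fin N₁ → Bool) (e' f' : Fin N₂ → Bool) →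
  (Disjoint e f → Disjoint e' f') → (Disjoint e' f' → Disjoint e f) →
  disjointᵇ e f ≡ disjointᵇ e' f'
disjointᵇ-≡ e f e' f' to from = bool-ext
  (disjointᵇ-complete e' f' ∘ to ∘ disjointᵇ-sound e f)
  (disjointᵇ-complete e f ∘ from ∘ disjointᵇ-sound e' f')

IsMatching : ∀ {N} → ℕ → List (Fin N → Bool) → Bool
IsMatching k s = ⌊ length s ℕP.≟ k ⌋ ∧ pairwiseDisjointᵇ s

matchings : ∀ {N} → ℕ → List (Fin N → Bool) → ℕ
matchings k xs = length (filterᵇ (IsMatching k) (sublists xs))

sublists-⊆ : ∀ {A : Set} (xs : List A) {s} → s ∈ sublists xs → s ⊆ xs
sublists-⊆ [] (here refl) = []
sublists-⊆ (x ∷ xs) s∈ with ∈P.∈-++⁻ (map (x ∷_) (sublists xs)) s∈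
... | inj₂ s∈′ = x ∷ʳ sublists-⊆ xs s∈′
... | inj₁ s∈′ with ∈P.∈-map⁻ (x ∷_) s∈′
...   | _ , s′∈ , refl = refl ∷ sublists-⊆ xs s′∈

AllPairs-resp-⊆ : ∀ {A : Set} {R : A → A → Set} {s xs : List A} → s ⊆ xs → AllPairs R xs → AllPairs R s
AllPairs-resp-⊆ [] [] = []
AllPairs-resp-⊆ (_ ∷ʳ s⊆) (_ ∷ rs) = AllPairs-resp-⊆ s⊆ rs
AllPairs-resp-⊆ (refl ∷ s⊆) (r ∷ rs) = All-resp-⊆ s⊆ r ∷ AllPairs-resp-⊆ s⊆ rs

sublists-map : ∀ {A B : Set} (f : A → B) xs → sublists (map f xs) ≡ map (map f) (sublists xs)
sublists-map f [] = refl
sublists-map f (x ∷ xs) = begin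
    map (f x ∷_) (sublists (map f xs)) ++ sublists (map f xs)
  ≡⟨ cong (λ S → map (f x ∷_) S ++ S) (sublists-map f xs) ⟩
    map (f x ∷_) (map (map f) S) ++ map (map f) S
  ≡⟨ cong (_++ map (map f) S) (trans (sym (ListP.map-∘ S)) (ListP.map-∘ S)) ⟩
    map (map f) (map (x ∷_) S) ++ map (map f) S
  ≡⟨ sym (ListP.map-++ (map f) (map (x ∷_) S) S) ⟩
    map (map f) (map (x ∷_) S ++ S)
  ∎
  where open ≡-Reasoning
        S = sublists xs

length-filterᵇ-map : ∀ {A B : Set} (p : B → Bool) (f : A → B) xs →
  length (filterᵇ p (map f xs)) ≡ length (filterᵇ (p ∘ f) xs)
length-filterᵇ-map p f [] = refl
length-filterᵇ-map p f (x ∷ xs) with p (f x)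
... | true = cong suc (length-filterᵇ-map p f xs)
... | false = length-filterᵇ-map p f xs

length-filterᵇ-cong : ∀ {A : Set} (p q : A → Bool) xs → (∀ {x} → x ∈ xs → p x ≡ q x) →
  length (filterᵇ p xs) ≡ length (filterᵇ q xs)
length-filterᵇ-cong p q [] h = refl
length-filterᵇ-cong p q (x ∷ xs) h with p x | q x | h (here refl)
... | true  | true  | refl = cong suc (length-filterᵇ-cong p q xs (h ∘ there))
... | false | false | refl = length-filterᵇ-cong p q xs (h ∘ there)

matchings-map : ∀ {A : Set} {N} (f : A → (Fin N → Bool)) k xs →
  matchings k (map f xs) ≡ length (filterᵇ (IsMatching k ∘ map f) (sublists xs))
matchings-map f k xs = trans (cong (length ∘ filterᵇ (IsMatching k)) (sublists-map f xs))
                             (length-filterᵇ-map (IsMatching k) (map f) (sublists xs))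

Edge² : ℕ → ℕ → Set
Edge² N₁ N₂ = (Fin N₁ → Bool) × (Fin N₂ → Bool)

SameDisjointness : ∀ {N₁ N₂} → Edge² N₁ N₂ → Edge² N₁ N₂ → Set
SameDisjointness (e₁ , e₂) (f₁ , f₂) = disjointᵇ e₁ f₁ ≡ disjointᵇ e₂ f₂

pairwiseDisjointᵇ-transfer : ∀ {N₁ N₂} (zs : List (Edge² N₁ N₂)) → AllPairs SameDisjointness zs →
  pairwiseDisjointᵇ (map proj₁ zs) ≡ pairwiseDisjointᵇ (map proj₂ zs)
pairwiseDisjointᵇ-transfer [] [] = refl
pairwiseDisjointᵇ-transfer (z ∷ zs) (same ∷ rest) =
  cong₂ _∧_ (allᵇ-transfer zs same) (pairwiseDisjointᵇ-transfer zs rest)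
  where
  allᵇ-transfer : ∀ ws → All (SameDisjointness z) ws →
    allᵇ (disjointᵇ (proj₁ z)) (map proj₁ ws) ≡ allᵇ (disjointᵇ (proj₂ z)) (map proj₂ ws)
  allᵇ-transfer [] [] = refl
  allᵇ-transfer (w ∷ ws) (h ∷ hs) = cong₂ _∧_ h (allᵇ-transfer ws hs)

matchings-transfer : ∀ {e N₁ N₂} (f : Fin e → Fin N₁ → Bool) (g : Fin e → Fin N₂ → Bool) →
  (∀ {i j} → i ≢ j → disjointᵇ (f i) (f j) ≡ disjointᵇ (g i) (g j)) →
  ∀ k → matchings k (tabulate f) ≡ matchings k (tabulate g)
matchings-transfer f g same k = begin
    matchings k (tabulate f)
  ≡⟨ cong (matchings k) (sym (ListP.map-tabulate fg proj₁)) ⟩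
    matchings k (map proj₁ zs)
  ≡⟨ matchings-map proj₁ k zs ⟩
    length (filterᵇ (IsMatching k ∘ map proj₁) (sublists zs))
  ≡⟨ length-filterᵇ-cong _ _ (sublists zs) agree ⟩
    length (filterᵇ (IsMatching k ∘ map proj₂) (sublists zs))
  ≡⟨ sym (matchings-map proj₂ k zs) ⟩
    matchings k (map proj₂ zs)
  ≡⟨ cong (matchings k) (ListP.map-tabulate fg proj₂) ⟩
    matchings k (tabulate g)
  ∎
  where
  open ≡-Reasoning
  fg = λ i → f i , g i
  zs = tabulate fg
  agree : ∀ {s} → s ∈ sublists zs → IsMatching k (map proj₁ s) ≡ IsMatching k (map proj₂ s)
  agree {s} s∈ = cong₂ _∧_
    (cong (λ l → ⌊ l ℕP.≟ k ⌋) (trans (ListP.length-map proj₁ s) (sym (ListP.length-map proj₂ s))))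
    (pairwiseDisjointᵇ-transfer s
      (AllPairs-resp-⊆ (sublists-⊆ zs s∈) (AllPairsP.tabulate⁺ same)))

endpoints : ∀ {n} → Fin n × Fin n → Fin n → Bool
endpoints (a , b) v = eqᵇ v a ∨ eqᵇ v b

module PowerEdges {n : ℕ} (G : Graph n) (r : ℕ) where
  private
    e = length (E G)
    M = e * (r ∸ 2)

  -- The edge list of Gʳ is a tabulation; this witness names its edge
  -- function, which is local to the definition of power.
  tabulated : Σ (Fin e → Fin (n + M) → Bool) λ h → edges (power G r) ≡ tabulate h
  tabulated = _ , refl

  edge : Fin e → Fin (n + M) → Bool
  edge = proj₁ tabulated

  edge-old : ∀ i u → edge i (u ↑ˡ M) ≡ endpoints (lookup (E G) i) u
  edge-old i u rewrite FinP.splitAt-↑ˡ n u M = refl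

  edge-disjoint : ∀ {i j} → i ≢ j →
    disjointᵇ (edge i) (edge j) ≡ disjointᵇ (endpoints (lookup (E G) i)) (endpoints (lookup (E G) j))
  edge-disjoint {i} {j} i≢j =
    disjointᵇ-≡ (edge i) (edge j) (endpoints (lookup (E G) i)) (endpoints (lookup (E G) j))
    (λ disj u → trans (sym (cong₂ _∧_ (edge-old i u) (edge-old j u))) (disj (u ↑ˡ M)))
    lift
    where
    -- new vertices lie in a single block, hence in at most one edge
    lift : Disjoint (endpoints (lookup (E G) i)) (endpoints (lookup (E G) j)) → Disjoint (edge i) (edge j)
    lift disj v with splitAt n v
    ... | inj₁ u = disj u
    ... | inj₂ w with proj₁ (remQuot (r ∸ 2) w) FinP.≟ i
    ...   | yes refl = eqᵇ-≢ i≢j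
    ...   | no _ = refl

  m-power : ∀ k → m (power G r) k ≡ m (graphHyper G) k
  m-power k = begin
      matchings k (tabulate edge)
    ≡⟨ matchings-transfer edge (endpoints ∘ lookup (E G)) edge-disjoint k ⟩
      matchings k (tabulate (endpoints ∘ lookup (E G)))
    ≡⟨ cong (matchings k) (sym (ListP.map-tabulate (lookup (E G)) endpoints)) ⟩
      matchings k (map endpoints (tabulate (lookup (E G))))
    ≡⟨ cong (matchings k ∘ map endpoints) (ListP.tabulate-lookup (E G)) ⟩
      matchings k (map endpoints (E G))
    ∎
    where open ≡-Reasoning

bit : Bool → ℕ
bit true = 1
bit false = 0

size : ∀ {N} → (Fin N → Bool) → ℕ
size {zero} f = 0
size {suc N} f = bit (f Fin.zero) + size (f ∘ Fin.suc)

size-≤ : ∀ {N} (f : Fin N → Bool) → size f ≤ N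
size-≤ {zero} f = z≤n
size-≤ {suc N} f with f Fin.zero
... | true = s≤s (size-≤ (f ∘ Fin.suc))
... | false = ℕP.m≤n⇒m≤1+n (size-≤ (f ∘ Fin.suc))

size-ext : ∀ {N} {f g : Fin N → Bool} → (∀ v → f v ≡ g v) → size f ≡ size g
size-ext {zero} h = refl
size-ext {suc N} h = cong₂ _+_ (cong bit (h Fin.zero)) (size-ext (h ∘ Fin.suc))

bit-∨ : ∀ a b → a ∧ b ≡ false → bit (a ∨ b) ≡ bit a + bit b
bit-∨ true false _ = refl
bit-∨ false b _ = refl

size-∨ : ∀ {N} (f g : Fin N → Bool) → Disjoint f g → size (λ v → f v ∨ g v) ≡ size f + size g
size-∨ {zero} f g disj = refl
size-∨ {suc N} f g disj
  rewrite bit-∨ (f Fin.zero) (g Fin.zero) (disj Fin.zero)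
        | size-∨ (f ∘ Fin.suc) (g ∘ Fin.suc) (disj ∘ Fin.suc)
  = interchange (bit (f Fin.zero)) (bit (g Fin.zero)) (size (f ∘ Fin.suc)) (size (g ∘ Fin.suc))
  where
  interchange : ∀ a b c d → a + b + (c + d) ≡ a + c + (b + d)
  interchange = solve-∀

size-empty : ∀ N → size {N} (λ _ → false) ≡ 0
size-empty zero = refl
size-empty (suc N) = size-empty N

size-point : ∀ {N} (a : Fin N) → size (λ v → eqᵇ v a) ≡ 1
size-point {suc N} Fin.zero rewrite eqᵇ-refl (Fin.zero {N}) =
  cong suc (trans (size-ext {N} (λ v → eqᵇ-≢ {a = Fin.suc v} {b = Fin.zero} (λ ()))) (size-empty N))
size-point {suc N} (Fin.suc a) rewrite eqᵇ-≢ {a = Fin.zero {N}} {b = Fin.suc a} (λ ()) =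
  trans (size-ext (λ v → eqᵇ-suc v a)) (size-point a)

size-endpoints : ∀ {N} {a b : Fin N} → a ≢ b → size (endpoints (a , b)) ≡ 2
size-endpoints {a = a} {b} a≢b = trans (size-∨ (λ v → eqᵇ v a) (λ v → eqᵇ v b) disj) (cong₂ _+_ (size-point a) (size-point b))
  where
  disj : Disjoint (λ v → eqᵇ v a) (λ v → eqᵇ v b)
  disj v with v FinP.≟ a
  ... | yes refl = eqᵇ-≢ a≢b
  ... | no _ = refl

union : ∀ {N} → List (Fin N → Bool) → Fin N → Bool
union [] v = false
union (f ∷ s) v = f v ∨ union s v

Disjoint-union : ∀ {N} (f : Fin N → Bool) s → (∀ {g} → g ∈ s → Disjoint f g) → Disjoint f (union s)
Disjoint-union f [] _ v = ∧-zeroʳ (f v)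
Disjoint-union f (g ∷ s) disj v = trans (∧-distribˡ-∨ (f v) (g v) (union s v))
  (cong₂ _∨_ (disj (here refl) v) (Disjoint-union f s (disj ∘ there) v))

size-union : ∀ {N r} (s : List (Fin N → Bool)) → All (λ f → size f ≡ r) s →
  pairwiseDisjointᵇ s ≡ true → size (union s) ≡ length s * r
size-union {N} [] [] _ = size-empty N
size-union {r = r} (f ∷ s) (size-f ∷ sizes) pd with ∧-true pd
... | f-disj , s-pd = trans
  (size-∨ f (union s) (Disjoint-union f s (λ {g} g∈ → disjointᵇ-sound f g (allᵇ-sound _ s f-disj g∈))))
  (cong₂ _+_ size-f (size-union s sizes s-pd))

filterᵇ-witness : ∀ {A : Set} (p : A → Bool) xs → length (filterᵇ p xs) ≢ 0 → Σ A λ x → x ∈ xs × p x ≡ true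
filterᵇ-witness p [] nonzero = ⊥-elim (nonzero refl)
filterᵇ-witness p (x ∷ xs) nonzero with p x in px
... | true = x , here refl , px
... | false with filterᵇ-witness p xs nonzero
...   | y , y∈ , py = y , there y∈ , py

matching-bound : ∀ {N r} (xs : List (Fin N → Bool)) → All (λ f → size f ≡ r) xs →
  ∀ k → matchings k xs ≢ 0 → k * r ≤ N
matching-bound xs uniform k nonzero with filterᵇ-witness (IsMatching k) (sublists xs) nonzero
... | s , s∈ , matching with ∧-true matching
...   | length≡k , pd with isYes-sound (length s ℕP.≟ k) length≡k
...     | refl = begin
  length s * _          ≡⟨ sym (size-union s (All-resp-⊆ (sublists-⊆ xs s∈) uniform) pd) ⟩
  size (union s)        ≤⟨ size-≤ (union s) ⟩
  _                     ∎
  where open ℕP.≤-Reasoning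

graph-2-uniform : ∀ {n} (G : Graph n) → (∀ {u v} → (u , v) ∈ E G → u ≢ v) →
  All (λ f → size f ≡ 2) (edges (graphHyper G))
graph-2-uniform G loop-free = AllP.map⁺ (All.tabulate (λ p∈ → size-endpoints (loop-free p∈)))

half-≤ : ∀ k e → k * 2 ≤ suc e → k ≤ e
half-≤ zero e _ = z≤n
half-≤ (suc j) e (s≤s h) = ℕP.≤-trans (s≤s (ℕP.m≤m*n j 2)) h

exponents-agree : ∀ s n e k → n ≡ suc e → k * 2 ≤ n →
  s + 2 * (n + e * s ∸ k * (2 + s)) ≡ e * s + (2 + s) * (n ∸ k * 2)
exponents-agree s .(suc e) e k refl 2k≤n = ℕP.+-cancelʳ-≡ (k * 2 * r) _ _ (begin
    s + 2 * t + k * 2 * r      ≡⟨ regroupₗ s t k ⟩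
    s + 2 * (t + k * r)        ≡⟨ cong (λ x → s + 2 * x) (ℕP.m∸n+n≡m kr≤N) ⟩
    s + 2 * (suc e + e * s)    ≡⟨ vertex-count s e ⟩
    e * s + r * suc e          ≡⟨ cong (λ x → e * s + r * x) (sym (ℕP.m∸n+n≡m 2k≤n)) ⟩
    e * s + r * (u + k * 2)    ≡⟨ regroupᵣ s e u k ⟩
    e * s + r * u + k * 2 * r  ∎)
  where
  open ≡-Reasoning
  r = 2 + s
  t = suc e + e * s ∸ k * r
  u = suc e ∸ k * 2
  kr≤N : k * r ≤ suc e + e * s
  kr≤N = ℕP.≤-trans (ℕP.≤-reflexive (ℕP.*-distribˡ-+ k 2 s))
           (ℕP.+-mono-≤ 2k≤n (ℕP.*-monoˡ-≤ s (half-≤ k e 2k≤n)))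
  regroupₗ : ∀ s t k → s + 2 * t + k * 2 * (2 + s) ≡ s + 2 * (t + k * (2 + s))
  regroupₗ = solve-∀
  vertex-count : ∀ s e → s + 2 * (suc e + e * s) ≡ e * s + (2 + s) * suc e
  vertex-count = solve-∀
  regroupᵣ : ∀ s e u k → e * s + (2 + s) * (u + k * 2) ≡ e * s + (2 + s) * u + k * 2 * (2 + s)
  regroupᵣ = solve-∀

pow-merge : ∀ (y : ℤ) a b c → y ^ℤ a *ℤ (y ^ℤ b) ^ℤ c ≡ y ^ℤ (a + b * c)
pow-merge y a b c = trans (cong (y ^ℤ a *ℤ_) (ℤP.^-*-assoc y b c)) (sym (ℤP.^-distribˡ-+-* y a (b * c)))

scale-term : ∀ (c₁ c₂ σ X₁ X₂ : ℤ) {m₁ m₂ : ℕ} → m₁ ≡ m₂ →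
  (m₂ ≢ 0 → c₁ *ℤ X₁ ≡ c₂ *ℤ X₂) → c₁ *ℤ (σ *ℤ + m₁ *ℤ X₁) ≡ c₂ *ℤ (σ *ℤ + m₂ *ℤ X₂)
scale-term c₁ c₂ σ X₁ X₂ {zero} refl _ = begin
    c₁ *ℤ (σ *ℤ + 0 *ℤ X₁)  ≡⟨ cong (λ z → c₁ *ℤ (z *ℤ X₁)) (ℤP.*-zeroʳ σ) ⟩
    c₁ *ℤ (+ 0 *ℤ X₁)       ≡⟨ ℤP.*-zeroʳ c₁ ⟩
    + 0                     ≡⟨ sym (ℤP.*-zeroʳ c₂) ⟩
    c₂ *ℤ (+ 0 *ℤ X₂)       ≡⟨ cong (λ z → c₂ *ℤ (z *ℤ X₂)) (sym (ℤP.*-zeroʳ σ)) ⟩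
    c₂ *ℤ (σ *ℤ + 0 *ℤ X₂)  ∎
  where open ≡-Reasoning
scale-term c₁ c₂ σ X₁ X₂ {suc m} refl same = begin
    c₁ *ℤ (a *ℤ X₁)  ≡⟨ swap c₁ a X₁ ⟩
    a *ℤ (c₁ *ℤ X₁)  ≡⟨ cong (a *ℤ_) (same (λ ())) ⟩
    a *ℤ (c₂ *ℤ X₂)  ≡⟨ sym (swap c₂ a X₂) ⟩
    c₂ *ℤ (a *ℤ X₂)  ∎
  where
  open ≡-Reasoning
  a = σ *ℤ + suc m
  swap : ∀ c a x → c *ℤ (a *ℤ x) ≡ a *ℤ (c *ℤ x)
  swap c a x = trans (sym (ℤP.*-assoc c a x)) (trans (cong (_*ℤ x) (ℤP.*-comm c a)) (ℤP.*-assoc a c x))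

sumTo-scale : ∀ (c d : ℤ) K (f g : ℕ → ℤ) → (∀ k → c *ℤ f k ≡ d *ℤ g k) →
  c *ℤ sumTo K f ≡ d *ℤ sumTo K g
sumTo-scale c d zero f g h = h 0
sumTo-scale c d (suc K) f g h = begin
    c *ℤ (sumTo K f ℤ.+ f (suc K))          ≡⟨ ℤP.*-distribˡ-+ c (sumTo K f) (f (suc K)) ⟩
    c *ℤ sumTo K f ℤ.+ c *ℤ f (suc K)       ≡⟨ cong₂ ℤ._+_ (sumTo-scale c d K f g h) (h (suc K)) ⟩
    d *ℤ sumTo K g ℤ.+ d *ℤ g (suc K)       ≡⟨ sym (ℤP.*-distribˡ-+ d (sumTo K g) (g (suc K))) ⟩
    d *ℤ (sumTo K g ℤ.+ g (suc K))          ∎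
  where open ≡-Reasoning

proposition3p3 : (n : ℕ) (T : Graph n) → IsTree T → (r : ℕ) → 3 ≤ r →
    (y : ℤ) →
    (y ^ℤ (r ∸ 2)) *ℤ φ r (power T r) (y ^ℤ 2)
      ≡ (y ^ℤ ((n ∸ 1) * (r ∸ 2))) *ℤ φ 2 (graphHyper T) (y ^ℤ r)
proposition3p3 n T ((loop-free , _) , _ , 1≤n , |E|≡n-1) r@(suc (suc s)) (s≤s (s≤s _)) y = begin
    y ^ℤ s *ℤ sumTo (length (edges (power T r))) termᵣ
  ≡⟨ cong (λ K → y ^ℤ s *ℤ sumTo K termᵣ) (ListP.length-tabulate (PowerEdges.edge T r)) ⟩
    y ^ℤ s *ℤ sumTo e termᵣ
  ≡⟨ sumTo-scale (y ^ℤ s) (y ^ℤ (e * s)) e termᵣ term₂ (λ k →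
       scale-term (y ^ℤ s) (y ^ℤ (e * s)) (sign k) (Xᵣ k) (X₂ k) (PowerEdges.m-power T r k) (same-power k)) ⟩
    y ^ℤ (e * s) *ℤ sumTo e term₂
  ≡⟨ cong₂ (λ a K → y ^ℤ (a * s) *ℤ sumTo K term₂) |E|≡n-1 (sym (ListP.length-map _ (E T))) ⟩
    y ^ℤ ((n ∸ 1) * s) *ℤ sumTo (length (edges (graphHyper T))) term₂
  ∎
  where
  open ≡-Reasoning
  e = length (E T)
  sign Xᵣ X₂ termᵣ term₂ : ℕ → ℤ
  sign k = (ℤ.- + 1) ^ℤ k
  Xᵣ k = (y ^ℤ 2) ^ℤ (n + e * s ∸ k * r)
  X₂ k = (y ^ℤ r) ^ℤ (n ∸ k * 2)
  termᵣ k = sign k *ℤ + m (power T r) k *ℤ Xᵣ k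
  term₂ k = sign k *ℤ + m (graphHyper T) k *ℤ X₂ k
  n≡1+e : n ≡ suc e
  n≡1+e = trans (sym (ℕP.m+[n∸m]≡n 1≤n)) (cong suc (sym |E|≡n-1))
  -- Steps (2) and (3): a nonzero term has 2k ≤ n, so the powers of y agree.
  same-power : ∀ k → m (graphHyper T) k ≢ 0 → y ^ℤ s *ℤ Xᵣ k ≡ y ^ℤ (e * s) *ℤ X₂ k
  same-power k nonzero = begin
      y ^ℤ s *ℤ (y ^ℤ 2) ^ℤ (n + e * s ∸ k * r)   ≡⟨ pow-merge y s 2 (n + e * s ∸ k * r) ⟩
      y ^ℤ (s + 2 * (n + e * s ∸ k * r))          ≡⟨ cong (y ^ℤ_) (exponents-agree s n e k n≡1+e 2k≤n) ⟩
      y ^ℤ (e * s + r * (n ∸ k * 2))              ≡⟨ sym (pow-merge y (e * s) r (n ∸ k * 2)) ⟩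
      y ^ℤ (e * s) *ℤ (y ^ℤ r) ^ℤ (n ∸ k * 2)     ∎
    where
    2k≤n : k * 2 ≤ n
    2k≤n = matching-bound (edges (graphHyper T)) (graph-2-uniform T loop-free) k nonzero
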